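{- If $\sigma$ is legal and quiescent, then any legal permutation of $\sigma$ is quiescent.
   Context: Events are invocations or responses, each associated with a process; an invocation matches a response iff they have the same process and operation. A run is sequential if (when non-empty) it starts with an invocation, each invocation at an even position $i<k$ is immediately followed by its matching response, and a final event at an even position is an invocation; a run is legal if its restriction to each process is sequential. An invocation is pending if no later event in the run is a matching response; a run is quiescent if it has no pending invocations. With $U=\Sigma\times\Sigma$, $\sigma\sim_U\sigma'$ iff $\sigma'$ is obtained from $\sigma$ by swapping adjacent events (i.e. $\sigma'$ is a permutation of $\sigma$); $\sigma'$ is a legal permutation of a legal run $\sigma$ iff $\sigma\sim_U\sigma'$ and $\sigma'$ is legal. -}

module Defs where

open import Data.List using (List; []; _∷_; filter; length; lookup)
open import Data.List.Relation.Binary.Permutation.Propositional using (_↭_)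
open import Data.Fin using (Fin; toℕ)
open import Data.Nat using (_<_)
open import Data.Product using (_×_; Σ)
open import Relation.Nullary using (¬_)
open import Relation.Binary.PropositionalEquality using (_≡_)
open import Relation.Binary.Definitions using (DecidableEquality)
open import Relation.Nullary.Decidable using (⌊_⌋)

-- Processes P and operations O are arbitrary types; process identity must be
-- decidable so that restriction of a run to a process can be computed.
module Runs {P O : Set} (_≟P_ : DecidableEquality P) where

  data Event : Set where
    inv : P → O → Event
    res : P → O → Event

  proc : Event → P
  proc (inv p _) = p
  proc (res p _) = p

  Run : Set
  Run = List Event

  data Matches : Event → Event → Set where
    match : ∀ {p o} → Matches (inv p o) (res p o)

  data IsInv : Event → Set where
    isInv : ∀ {p o} → IsInv (inv p o)

  data Sequential : Run → Set where
    seq-[]   : Sequential []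
    seq-last : ∀ {e} → IsInv e → Sequential (e ∷ [])
    seq-pair : ∀ {i r ρ} → Matches i r → Sequential ρ → Sequential (i ∷ r ∷ ρ)

  _∣_ : Run → P → Run
  σ ∣ p = filter (λ e → proc e ≟P p) σ

  Legal : Run → Set
  Legal σ = ∀ p → Sequential (σ ∣ p)

  Pending : (σ : Run) → Fin (length σ) → Set
  Pending σ k = IsInv (lookup σ k) ×
    (∀ (j : Fin (length σ)) → toℕ k < toℕ j → ¬ Matches (lookup σ k) (lookup σ j))

  Quiescent : Run → Set
  Quiescent σ = ∀ k → ¬ Pending σ k

  LegalPermutation : Run → Run → Set
  LegalPermutation σ σ' = (σ ↭ σ') × Legal σ'

module Submission where

-- Count invocations and responses in the restriction
-- σ ∣ p of a run to a single process p.  A sequential run alternates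
-- invocations with their matching responses, so it has exactly as many
-- invocations as responses when it has no pending invocation, and exactly one
-- invocation more when it has one (which must then be its last event).
--
-- A pending invocation of a run is also pending in the restriction to its
-- process, and conversely (no event of another process can answer it).  So in
-- the legal quiescent run σ every restriction σ ∣ p is balanced.  If the legal
-- permutation σ' had a pending invocation by p, then σ' ∣ p would carry one
-- surplus invocation; but σ ∣ p and σ' ∣ p are permutations of each other and
-- so have the same counts, a contradiction.

open import Defs
open import Relation.Binary.Definitions using (DecidableEquality)
open import Data.List using ([]; _∷_; map; lookup)
open import Data.List.Relation.Unary.All as All using (All; []; _∷_)
open import Data.List.Relation.Unary.All.Properties using (all-filter; filter⁺; filter⁻)
open import Data.List.Relation.Binary.Permutation.Propositional using (_↭_)
open import Data.List.Relation.Binary.Permutation.Propositional.Properties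
  using (filter-↭; map⁺)
open import Data.Fin using (zero; suc)
open import Data.Nat using (ℕ; suc; s≤s; z≤n)
open import Data.Nat.ListAction using (sum)
open import Data.Nat.ListAction.Properties using (sum-↭)
open import Data.Nat.Properties using (1+n≢n)
open import Data.Product using (_,_)
open import Function using (_∘_)
open import Relation.Nullary using (¬_; yes; no; ¬?)
open import Relation.Unary using (Decidable)
open import Relation.Binary.PropositionalEquality
  using (_≡_; refl; sym; trans; cong; module ≡-Reasoning)
open import Data.Empty using (⊥-elim)

-- All, read through positions: Pending quantifies over Fin-indexed lookups.
all-fromLookup : ∀ {A : Set} {Q : A → Set} xs → (∀ j → Q (lookup xs j)) → All Q xs
all-fromLookup []       q = []
all-fromLookup (x ∷ xs) q = q zero ∷ all-fromLookup xs (q ∘ suc)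

all-lookup : ∀ {A : Set} {Q : A → Set} {xs} → All Q xs → ∀ j → Q (lookup xs j)
all-lookup (qx ∷ _)   zero    = qx
all-lookup (_  ∷ qxs) (suc j) = all-lookup qxs j

module Proof {P O : Set} (_≟P_ : DecidableEquality P) where
  open Runs {P} {O} _≟P_

  ofProcess? : (p : P) → Decidable (λ e → proc e ≡ p)
  ofProcess? p e = proc e ≟P p

  Unanswered : Event → Run → Set
  Unanswered e β = All (λ x → ¬ Matches e x) β

  -- A run has a pending invocation: some suffix starts with an invocation
  -- that no later event answers.  This is Pending without the indices.
  data HasPending : Run → Set where
    here  : ∀ {e β} → IsInv e → Unanswered e β → HasPending (e ∷ β)
    there : ∀ {x σ} → HasPending σ → HasPending (x ∷ σ)

  pending⇒hasPending : ∀ σ k → Pending σ k → HasPending σ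
  pending⇒hasPending (e ∷ β) zero (invocation , unanswered) =
    here invocation (all-fromLookup β (λ j → unanswered (suc j) (s≤s z≤n)))
  pending⇒hasPending (x ∷ σ) (suc k) (invocation , unanswered) =
    there (pending⇒hasPending σ k (invocation , λ j k<j → unanswered (suc j) (s≤s k<j)))

  hasPending⇒¬quiescent : ∀ {σ} → HasPending σ → ¬ Quiescent σ
  hasPending⇒¬quiescent (here invocation unanswered) quiescent =
    quiescent zero (invocation , λ { zero () ; (suc j) _ → all-lookup unanswered j })
  hasPending⇒¬quiescent (there h) quiescent =
    hasPending⇒¬quiescent h (λ k (invocation , unanswered) →
      quiescent (suc k) (invocation , λ { zero () ; (suc j) (s≤s k<j) → unanswered j k<j }))

  matches-proc : ∀ {e x} → Matches e x → proc x ≡ proc e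
  matches-proc match = refl

  -- Events of processes other than p never answer an invocation of p, so
  -- being unanswered in σ ∣ p already means being unanswered in σ.
  unanswered-restrict⁻ : ∀ {e} p σ → proc e ≡ p → Unanswered e (σ ∣ p) → Unanswered e σ
  unanswered-restrict⁻ p σ pe unanswered =
    filter⁻ (ofProcess? p) unanswered
      (All.map (λ x≢p m → x≢p (trans (matches-proc m) pe))
        (all-filter (¬? ∘ ofProcess? p) σ))

  hasPending-restrict⁻ : ∀ p σ → HasPending (σ ∣ p) → HasPending σ
  hasPending-restrict⁻ p (x ∷ σ) h with proc x ≟P p | h
  ... | yes px | here invocation unanswered =
          here invocation (unanswered-restrict⁻ p σ px unanswered)
  ... | yes _  | there h′ = there (hasPending-restrict⁻ p σ h′)
  ... | no _   | h′       = there (hasPending-restrict⁻ p σ h′)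

  pendingProcess : ∀ {σ} → HasPending σ → P
  pendingProcess (here {e} _ _) = proc e
  pendingProcess (there h)      = pendingProcess h

  hasPending-restrict : ∀ {σ} (h : HasPending σ) → HasPending (σ ∣ pendingProcess h)
  hasPending-restrict (here {e} invocation unanswered) with proc e ≟P proc e
  ... | yes _   = here invocation (filter⁺ (ofProcess? (proc e)) unanswered)
  ... | no p≢p  = ⊥-elim (p≢p refl)
  hasPending-restrict (there {x} h) with proc x ≟P pendingProcess h
  ... | yes _ = there (hasPending-restrict h)
  ... | no _  = hasPending-restrict h

  -- Weighted event counts; as sums of weights they are invariant under
  -- permutation, which is how σ and σ′ are compared.
  count : (Event → ℕ) → Run → ℕ
  count w ρ = sum (map w ρ)

  count-↭ : ∀ w {ρ ρ′} → ρ ↭ ρ′ → count w ρ ≡ count w ρ′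
  count-↭ w ρ↭ρ′ = sum-↭ (map⁺ w ρ↭ρ′)

  invocationWeight responseWeight : Event → ℕ
  invocationWeight (inv _ _) = 1
  invocationWeight (res _ _) = 0
  responseWeight   (inv _ _) = 0
  responseWeight   (res _ _) = 1

  #inv #res : Run → ℕ
  #inv = count invocationWeight
  #res = count responseWeight

  sequential-balanced : ∀ {ρ} → Sequential ρ → ¬ HasPending ρ → #inv ρ ≡ #res ρ
  sequential-balanced seq-[]                _         = refl
  sequential-balanced (seq-last invocation) noPending = ⊥-elim (noPending (here invocation []))
  sequential-balanced (seq-pair match s)    noPending =
    cong suc (sequential-balanced s (noPending ∘ there ∘ there))

  -- A sequential run with a pending invocation has exactly one surplus
  -- invocation: the pending one, which must be the last event.
  sequential-surplus : ∀ {ρ} → Sequential ρ → HasPending ρ → #inv ρ ≡ suc (#res ρ)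
  sequential-surplus (seq-last isInv)   (here _ [])             = refl
  sequential-surplus (seq-last _)       (there ())
  sequential-surplus (seq-pair match _) (here _ (answered ∷ _)) = ⊥-elim (answered match)
  sequential-surplus (seq-pair match _) (there (here () _))
  sequential-surplus (seq-pair match s) (there (there h))       = cong suc (sequential-surplus s h)

  legal-quiescent-balanced : ∀ σ → Legal σ → Quiescent σ → ∀ p → #inv (σ ∣ p) ≡ #res (σ ∣ p)
  legal-quiescent-balanced σ legal quiescent p =
    sequential-balanced (legal p)
      (λ pending → hasPending⇒¬quiescent (hasPending-restrict⁻ p σ pending) quiescent)

  main : (σ σ′ : Run) → Legal σ → Quiescent σ → LegalPermutation σ σ′ → Quiescent σ′
  main σ σ′ legal quiescent (σ↭σ′ , legal′) k pendingₖ = 1+n≢n (begin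
    suc (#res (σ′ ∣ p)) ≡⟨ sym (sequential-surplus (legal′ p) pending′) ⟩
    #inv (σ′ ∣ p)       ≡⟨ sym (count-↭ invocationWeight restricted↭) ⟩
    #inv (σ ∣ p)        ≡⟨ legal-quiescent-balanced σ legal quiescent p ⟩
    #res (σ ∣ p)        ≡⟨ count-↭ responseWeight restricted↭ ⟩
    #res (σ′ ∣ p)       ∎)
    where
    open ≡-Reasoning
    pending : HasPending σ′
    pending = pending⇒hasPending σ′ k pendingₖ
    p : P
    p = pendingProcess pending
    pending′ : HasPending (σ′ ∣ p)
    pending′ = hasPending-restrict pending
    restricted↭ : σ ∣ p ↭ σ′ ∣ p
    restricted↭ = filter-↭ (ofProcess? p) σ↭σ′

mainTheorem4 : {P O : Set} (_≟P_ : DecidableEquality P) →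
    let open Runs {P} {O} _≟P_ in
    (σ σ' : Run) → Legal σ → Quiescent σ → LegalPermutation σ σ' → Quiescent σ'
mainTheorem4 _≟P_ = Proof.main _≟P_
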